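{- Let $\Delta\subseteq\mathbb{N}^d$ be a finite standard set. Then the graph $G'(\Delta)$ is the canonicalization of the standard graph $G(\Delta)$.
   Context: A finite standard set is a finite $\Delta\subseteq\mathbb{N}^d$ whose complement $C$ satisfies $C+\mathbb{N}^d=C$. Let $q^d\colon\mathbb{N}^d\to\mathbb{N}^{d-1}$ forget the last coordinate and $h_\Delta(\gamma)=|(q^d)^{ -1}(\gamma)\cap\Delta|$. $G(\Delta)$ is the labeled graph with nodes $q^d(\Delta)$, edges $(\gamma+e_i,\gamma)$ whenever both lie in $q^d(\Delta)$ ($e_i$ standard basis of $\mathbb{N}^{d-1}$), labels $h_\Delta(\gamma)$. For $a\ge1$ the isohypse $\Delta^a=\{\gamma\in q^d(\Delta):h_\Delta(\gamma)=a\}$. A subset of $\mathbb{N}^{d-1}$ is connected if any two of its points are joined by a sequence in it whose consecutive terms differ by some $\pm e_i$; connected components are maximal connected subsets. $G'(\Delta)$ has as nodes the connected components of all isohypses, the component of $\Delta^a$ having label $a$, and an edge from a component $B$ to a different component $B'$ iff there are $\gamma'\in B,\gamma\in B'$ with $\gamma'=\gamma+e_i$ for some $i$. The canonicalization of a standard labeled graph $G$ (finite nodes, loopless directed edges, labels $\ell\ge0$ with $\ell(a)\le\ell(b)$ on edges) is obtained by deleting all nodes of label $0$ (with their edges), then taking as nodes the classes of the equivalence relation generated by $a\sim b$ for edges $(a,b)$ with $\ell(a)=\ell(b)$, each class labeled by the common label, with an edge from class $[a]$ to a different class $[b]$ iff some edge of $G$ goes from an element of $[a]$ to an element of $[b]$.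 -}

module Defs where

open import Level using (0ℓ)
open import Data.Nat using (ℕ; _+_; _≤_; _≥_; suc)
open import Data.Fin using (Fin)
open import Data.Vec using (Vec; zipWith; updateAt; init)
open import Data.Vec.Properties using (≡-dec)
open import Data.List using (List; length; filter)
open import Data.List.Membership.Propositional using (_∈_; _∉_)
open import Data.Product using (Σ; ∃; _×_; _,_)
open import Data.Sum using (_⊎_)
open import Relation.Nullary using (¬_)
open import Relation.Unary using (Pred)
open import Relation.Binary.PropositionalEquality using (_≡_; _≢_)
open import Relation.Binary.Construct.Closure.Equivalence using (EqClosure)
open import Relation.Binary.Construct.Closure.ReflexiveTransitive using (Star)
import Data.Nat as N

Pt : ℕ → Set
Pt k = Vec ℕ k

Subset : ℕ → Set₁
Subset k = Pred (Pt k) 0ℓ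

_⊕_ : ∀ {k} → Pt k → Pt k → Pt k
x ⊕ y = zipWith _+_ x y

_+e_ : ∀ {k} → Pt k → Fin k → Pt k
γ +e i = updateAt γ i suc

q : ∀ {k} → Pt (suc k) → Pt k
q = init

_≐_ : ∀ {k} → Subset k → Subset k → Set
S ≐ T = ∀ x → (S x → T x) × (T x → S x)

_⊆_ : ∀ {k} → Subset k → Subset k → Set
S ⊆ T = ∀ x → S x → T x

-- Finite standard sets, given by a duplicate-free list of their elements.
-- Standardness: the complement C satisfies C + ℕ^d ⊆ C.

IsStandardSet : ∀ {d} → List (Pt d) → Set
IsStandardSet {d} Δ = ∀ (x y : Pt d) → x ∉ Δ → (x ⊕ y) ∉ Δ

h : ∀ {k} → List (Pt (suc k)) → Pt k → ℕ
h Δ γ = length (filter (λ x → ≡-dec N._≟_ (q x) γ) Δ)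

InQ : ∀ {k} → List (Pt (suc k)) → Pt k → Set
InQ Δ γ = ∃ λ x → x ∈ Δ × q x ≡ γ

record LGraph (V : Set) : Set₁ where
  field
    Node  : V → Set
    Edge  : V → V → Set
    label : V → ℕ

open LGraph public

IsStandardGraph : ∀ {V} → LGraph V → Set
IsStandardGraph {V} G =
  (∃ λ (l : List V) → ∀ v → Node G v → v ∈ l)
  × (∀ a b → Edge G a b → Node G a × Node G b)
  × (∀ a → ¬ Edge G a a)
  × (∀ a b → Edge G a b → label G a ≤ label G b)

-- Canonicalization of a labeled graph G on V (nodes are subsets of V,
-- namely classes of an equivalence relation, compared extensionally).

module Canon {V : Set} (G : LGraph V) where
  Node₀ : V → Set
  Node₀ a = Node G a × label G a ≢ 0

  Edge₀ : V → V → Set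
  Edge₀ a b = Node₀ a × Node₀ b × Edge G a b

  Gen : V → V → Set
  Gen a b = Edge₀ a b × label G a ≡ label G b

  _~_ : V → V → Set
  _~_ = EqClosure Gen

  Cls : V → Pred V 0ℓ
  Cls a = λ b → a ~ b

  SameSet : Pred V 0ℓ → Pred V 0ℓ → Set
  SameSet S T = ∀ x → (S x → T x) × (T x → S x)

  CNode : Pred V 0ℓ → Set
  CNode S = ∃ λ a → Node₀ a × SameSet S (Cls a)

  CLabel : Pred V 0ℓ → ℕ → Set
  CLabel S n = ∃ λ a → Node₀ a × SameSet S (Cls a) × label G a ≡ n

  CEdge : Pred V 0ℓ → Pred V 0ℓ → Set
  CEdge S T = ¬ SameSet S T × ∃ λ a → ∃ λ b → S a × T b × Edge₀ a b

GΔ : ∀ {k} → List (Pt (suc k)) → LGraph (Pt k)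
GΔ {k} Δ = record
  { Node  = InQ Δ
  ; Edge  = λ a b → InQ Δ a × InQ Δ b × ∃ λ (i : Fin k) → a ≡ b +e i
  ; label = h Δ
  }

Adjacent : ∀ {k} → Pt k → Pt k → Set
Adjacent {k} x y = ∃ λ (i : Fin k) → (y ≡ x +e i) ⊎ (x ≡ y +e i)

StepIn : ∀ {k} → Subset k → Pt k → Pt k → Set
StepIn A x y = A x × A y × Adjacent x y

Connected : ∀ {k} → Subset k → Set
Connected A = ∀ x y → A x → A y → Star (StepIn A) x y

IsComponent : ∀ {k} → Subset k → Subset k → Set₁
IsComponent {k} A B =
  B ⊆ A × Connected B × (∃ λ x → B x)
  × (∀ (D : Subset k) → B ⊆ D → D ⊆ A → Connected D → D ⊆ B)

Isohypse : ∀ {k} → List (Pt (suc k)) → ℕ → Subset k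
Isohypse Δ a γ = InQ Δ γ × h Δ γ ≡ a

G'Label : ∀ {k} → List (Pt (suc k)) → Subset k → ℕ → Set₁
G'Label Δ B a = a ≥ 1 × IsComponent (Isohypse Δ a) B

G'Node : ∀ {k} → List (Pt (suc k)) → Subset k → Set₁
G'Node Δ B = ∃ λ a → G'Label Δ B a

G'Edge : ∀ {k} → List (Pt (suc k)) → Subset k → Subset k → Set
G'Edge {k} Δ B B' =
  ¬ (B ≐ B') × ∃ λ γ' → ∃ λ γ → B γ' × B' γ × ∃ λ (i : Fin k) → γ' ≡ γ +e i

-- (1) G(Δ) is a standard labeled graph.  The only non-trivial condition is
--     that labels increase along edges, i.e. h(γ + e_i) ≤ h(γ).  We read
--     h(γ) as the length of the duplicate-free list of "heights" t with
--     γ ∷ʳ t ∈ Δ; since Δ is closed downwards (its complement is closed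
--     upwards), every height over γ + e_i is also a height over γ, and a
--     duplicate-free sublist is never longer than the list containing it.
--
-- (2) Nodes, labels and edges agree.  After deleting label 0, two adjacent points are
--     identified exactly when they lie in a common isohypse, so an
--     equivalence class of a point of Δ^n (n ≥ 1) is a connected subset of
--     Δ^n containing every connected subset of Δ^n through that point:
--     the classes are precisely the connected components of the isohypses.
--     Edges then match because both graphs join two node-sets by an edge
--     exactly when some pair of their points differs by a unit vector.
module Submission where

open import Defs
open import Data.Nat using (ℕ; suc)
open import Data.List using (List)
open import Data.List.Relation.Unary.Unique.Propositional using (Unique)
open import Data.Product using (_×_)
open import Function.Bundles using (_⇔_)

open import Data.Nat using (_≤_; z≤n; s≤s; _≟_)
open import Data.Nat.Properties
  using (+-comm; +-identityʳ; 1+n≢n; n>0⇒n≢0; n≢0⇒n>0; module ≤-Reasoning)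
open import Data.Fin using (Fin; inject₁; zero; suc)
open import Data.Vec using (_∷_; _∷ʳ_; last; initLast; replicate; lookup)
open import Data.Vec.Properties using (≡-dec; init-∷ʳ; last-∷ʳ; lookup∘updateAt; zipWith-identityʳ)
open import Data.List using ([]; _∷_; _++_; length; filter; map)
open import Data.List.Properties using (length-++-sucʳ; length-map)
open import Data.List.Membership.Propositional using (_∈_)
open import Data.List.Membership.Propositional.Properties
  using (∈-∃++; ∈-++⁻; ∈-++⁺ˡ; ∈-++⁺ʳ; ∈-filter⁺; ∈-filter⁻; ∈-map⁺; ∈-map⁻)
import Data.List.Membership.DecPropositional as DecMembership
open import Data.List.Relation.Unary.Any using (here; there)
open import Data.List.Relation.Unary.All using (All; _∷_)
import Data.List.Relation.Unary.All as All
open import Data.List.Relation.Unary.All.Properties using (all-filter)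
open import Data.List.Relation.Unary.AllPairs using (AllPairs; []; _∷_)
import Data.List.Relation.Unary.AllPairs.Properties as AllPairs
import Data.List.Relation.Unary.Unique.Propositional.Properties as Unique
open import Data.Product using (_,_; proj₁; proj₂)
open import Data.Sum using (inj₁; inj₂)
open import Data.Empty using (⊥-elim)
open import Relation.Nullary using (yes; no)
open import Relation.Binary.PropositionalEquality
  using (_≡_; _≢_; refl; sym; trans; cong; cong₂; subst; module ≡-Reasoning)
open import Relation.Binary.Construct.Closure.Symmetric using (SymClosure; fwd; bwd)
open import Relation.Binary.Construct.Closure.ReflexiveTransitive using (Star; ε; _◅_; _◅◅_)
import Relation.Binary.Construct.Closure.ReflexiveTransitive as Star
import Relation.Binary.Construct.Closure.Equivalence as EqClosure
open import Function.Bundles using (mk⇔; module Equivalence)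

unique-⊆-length : ∀ {A : Set} {xs ys : List A} →
                  Unique xs → (∀ {x} → x ∈ xs → x ∈ ys) → length xs ≤ length ys
unique-⊆-length {xs = []} _ _ = z≤n
unique-⊆-length {xs = x ∷ xs} (x∉xs ∷ uxs) xs⊆ys
  with ys₁ , ys₂ , refl ← ∈-∃++ (xs⊆ys (here refl)) = begin
    suc (length xs)           ≤⟨ s≤s (unique-⊆-length uxs xs⊆ys₁ys₂) ⟩
    suc (length (ys₁ ++ ys₂)) ≡⟨ sym (length-++-sucʳ ys₁ x ys₂) ⟩
    length (ys₁ ++ x ∷ ys₂)   ∎
  where
  open ≤-Reasoning
  -- removing the occurrence of x keeps the remaining elements, all ≠ x
  xs⊆ys₁ys₂ : ∀ {y} → y ∈ xs → y ∈ ys₁ ++ ys₂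
  xs⊆ys₁ys₂ y∈xs with ∈-++⁻ ys₁ (xs⊆ys (there y∈xs))
  ... | inj₁ y∈ys₁         = ∈-++⁺ˡ y∈ys₁
  ... | inj₂ (here refl)   = ⊥-elim (All.lookup x∉xs y∈xs refl)
  ... | inj₂ (there y∈ys₂) = ∈-++⁺ʳ ys₁ y∈ys₂

allPairs-weaken : ∀ {A : Set} {P : A → Set} {R S : A → A → Set} →
                  (∀ {x y} → P x → P y → R x y → S x y) →
                  ∀ {xs} → All P xs → AllPairs R xs → AllPairs S xs
allPairs-weaken f _ [] = []
allPairs-weaken f (px ∷ pxs) (rxs ∷ rs) =
  All.zipWith (λ (rxy , py) → f px py rxy) (rxs , pxs) ∷ allPairs-weaken f pxs rs

e : ∀ {n} → Fin n → Pt n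
e {n} i = replicate n 0 +e i

+e≡⊕e : ∀ {n} (x : Pt n) (i : Fin n) → x +e i ≡ x ⊕ e i
+e≡⊕e (a ∷ x) zero    = cong₂ _∷_ (+-comm 1 a) (sym (zipWith-identityʳ +-identityʳ x))
+e≡⊕e (a ∷ x) (suc i) = cong₂ _∷_ (sym (+-identityʳ a)) (+e≡⊕e x i)

∷ʳ-+e : ∀ {n} (x : Pt n) (i : Fin n) (t : ℕ) → (x +e i) ∷ʳ t ≡ (x ∷ʳ t) +e inject₁ i
∷ʳ-+e (a ∷ x) zero    t = refl
∷ʳ-+e (a ∷ x) (suc i) t = cong (a ∷_) (∷ʳ-+e x i t)

+e-no-fixpoint : ∀ {n} (x : Pt n) (i : Fin n) → x ≢ x +e i
+e-no-fixpoint x i x≡x+eᵢ =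
  1+n≢n (sym (trans (cong (λ v → lookup v i) x≡x+eᵢ) (lookup∘updateAt i x)))

q-∷ʳ-last : ∀ {n} (x : Pt (suc n)) → x ≡ q x ∷ʳ last x
q-∷ʳ-last x = proj₂ (proj₂ (initLast x))

standard-downward-closed : ∀ {d} {Δ : List (Pt d)} → IsStandardSet Δ →
                           ∀ x y → x ⊕ y ∈ Δ → x ∈ Δ
standard-downward-closed {Δ = Δ} std x y x⊕y∈Δ with x ∈? Δ
  where open DecMembership (≡-dec _≟_)
... | yes x∈Δ = x∈Δ
... | no  x∉Δ = ⊥-elim (std x y x∉Δ x⊕y∈Δ)

module Fibres {k : ℕ} (Δ : List (Pt (suc k))) where

  fibre : Pt k → List (Pt (suc k))
  fibre γ = filter (λ x → ≡-dec _≟_ (q x) γ) Δ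

  heights : Pt k → List ℕ
  heights γ = map last (fibre γ)

  length-heights : ∀ γ → length (heights γ) ≡ h Δ γ
  length-heights γ = length-map last (fibre γ)

  heights-sound : ∀ {γ t} → t ∈ heights γ → γ ∷ʳ t ∈ Δ
  heights-sound {γ} t∈ with x , x∈fibre , refl ← ∈-map⁻ last t∈
    with x∈Δ , refl ← ∈-filter⁻ (λ x → ≡-dec _≟_ (q x) γ) {xs = Δ} x∈fibre =
    subst (_∈ Δ) (q-∷ʳ-last x) x∈Δ

  heights-complete : ∀ {γ t} → γ ∷ʳ t ∈ Δ → t ∈ heights γ
  heights-complete {γ} {t} γt∈Δ =
    subst (_∈ heights γ) (last-∷ʳ t γ)
      (∈-map⁺ last (∈-filter⁺ (λ x → ≡-dec _≟_ (q x) γ) γt∈Δ (init-∷ʳ t γ)))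

  heights-unique : Unique Δ → ∀ γ → Unique (heights γ)
  heights-unique uΔ γ =
    AllPairs.map⁺ (allPairs-weaken distinct-heights
                     (all-filter (λ x → ≡-dec _≟_ (q x) γ) Δ)
                     (Unique.filter⁺ (λ x → ≡-dec _≟_ (q x) γ) uΔ))
    where
    distinct-heights : ∀ {x y} → q x ≡ γ → q y ≡ γ → x ≢ y → last x ≢ last y
    distinct-heights {x} {y} qx≡γ qy≡γ x≢y lx≡ly = x≢y (begin
      x                 ≡⟨ q-∷ʳ-last x ⟩
      q x ∷ʳ last x     ≡⟨ cong₂ _∷ʳ_ (trans qx≡γ (sym qy≡γ)) lx≡ly ⟩
      q y ∷ʳ last y     ≡⟨ sym (q-∷ʳ-last y) ⟩
      y                 ∎)
      where open ≡-Reasoning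

  -- h is antitone: the heights over γ + e_i are heights over γ.
  h-antitone : Unique Δ → IsStandardSet Δ → ∀ γ i → h Δ (γ +e i) ≤ h Δ γ
  h-antitone uΔ std γ i = begin
    h Δ (γ +e i)              ≡⟨ sym (length-heights (γ +e i)) ⟩
    length (heights (γ +e i)) ≤⟨ unique-⊆-length (heights-unique uΔ (γ +e i)) lower ⟩
    length (heights γ)        ≡⟨ length-heights γ ⟩
    h Δ γ                     ∎
    where
    open ≤-Reasoning
    lower : ∀ {t} → t ∈ heights (γ +e i) → t ∈ heights γ
    lower {t} t∈ = heights-complete (standard-downward-closed std (γ ∷ʳ t) (e (inject₁ i))
      (subst (_∈ Δ) (trans (∷ʳ-+e γ i t) (+e≡⊕e (γ ∷ʳ t) (inject₁ i))) (heights-sound t∈)))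

GΔ-standard : ∀ {k} {Δ : List (Pt (suc k))} → Unique Δ → IsStandardSet Δ →
              IsStandardGraph (GΔ Δ)
GΔ-standard {Δ = Δ} uΔ std =
    (map q Δ , λ { γ (x , x∈Δ , refl) → ∈-map⁺ q x∈Δ })
  , (λ { _ _ (a∈ , b∈ , _) → a∈ , b∈ })
  , (λ { a (_ , _ , i , a≡a+eᵢ) → +e-no-fixpoint a i a≡a+eᵢ })
  , (λ { _ b (_ , _ , i , refl) → Fibres.h-antitone Δ uΔ std b i })

module Components {k : ℕ} (Δ : List (Pt (suc k))) where

  open Canon (GΔ Δ)

  isohypse-node₀ : ∀ {n x} → n ≢ 0 → Isohypse Δ n x → Node₀ x
  isohypse-node₀ n≢0 (x∈ , hx≡n) = x∈ , λ hx≡0 → n≢0 (trans (sym hx≡n) hx≡0)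

  gen-isohypse : ∀ {n x y} → Isohypse Δ n x → SymClosure Gen x y → Isohypse Δ n y
  gen-isohypse (_ , hx≡n) (fwd ((_ , (y∈ , _) , _) , hx≡hy)) = y∈ , trans (sym hx≡hy) hx≡n
  gen-isohypse (_ , hx≡n) (bwd (((y∈ , _) , _) , hy≡hx)) = y∈ , trans hy≡hx hx≡n

  ~-isohypse : ∀ {n x y} → Isohypse Δ n x → x ~ y → Isohypse Δ n y
  ~-isohypse x∈Δⁿ ε              = x∈Δⁿ
  ~-isohypse x∈Δⁿ (step ◅ steps) = ~-isohypse (gen-isohypse x∈Δⁿ step) steps

  gen-adjacent : ∀ {x y} → SymClosure Gen x y → Adjacent x y
  gen-adjacent (fwd ((_ , _ , (_ , _ , i , x≡y+eᵢ)) , _)) = i , inj₂ x≡y+eᵢ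
  gen-adjacent (bwd ((_ , _ , (_ , _ , i , y≡x+eᵢ)) , _)) = i , inj₁ y≡x+eᵢ

  adjacent-gen : ∀ {n x y} → n ≢ 0 → Isohypse Δ n x → Isohypse Δ n y →
                 Adjacent x y → SymClosure Gen x y
  adjacent-gen n≢0 x∈Δⁿ@(x∈ , hx≡n) y∈Δⁿ@(y∈ , hy≡n) (i , inj₁ y≡x+eᵢ) =
    bwd ((isohypse-node₀ n≢0 y∈Δⁿ , isohypse-node₀ n≢0 x∈Δⁿ , (y∈ , x∈ , i , y≡x+eᵢ))
        , trans hy≡n (sym hx≡n))
  adjacent-gen n≢0 x∈Δⁿ@(x∈ , hx≡n) y∈Δⁿ@(y∈ , hy≡n) (i , inj₂ x≡y+eᵢ) =
    fwd ((isohypse-node₀ n≢0 x∈Δⁿ , isohypse-node₀ n≢0 y∈Δⁿ , (x∈ , y∈ , i , x≡y+eᵢ))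
        , trans hx≡n (sym hy≡n))

  path⇒~ : ∀ {n} {D : Subset k} → n ≢ 0 → D ⊆ Isohypse Δ n →
           ∀ {x y} → Star (StepIn D) x y → x ~ y
  path⇒~ n≢0 D⊆Δⁿ = Star.map λ { (dx , dy , adj) →
    adjacent-gen n≢0 (D⊆Δⁿ _ dx) (D⊆Δⁿ _ dy) adj }

  ~⇒path : ∀ {a x y} → a ~ x → x ~ y → Star (StepIn (Cls a)) x y
  ~⇒path a~x ε              = ε
  ~⇒path a~x (step ◅ steps) = (a~x , a~y , gen-adjacent step) ◅ ~⇒path a~y steps
    where a~y = a~x ◅◅ (step ◅ ε)

  class-connected : ∀ a → Connected (Cls a)
  class-connected a x y a~x a~y =
    ~⇒path a~x (EqClosure.transitive Gen (EqClosure.symmetric Gen a~x) a~y)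

  class-is-component : ∀ {n a} → n ≢ 0 → Isohypse Δ n a → IsComponent (Isohypse Δ n) (Cls a)
  class-is-component n≢0 a∈Δⁿ =
      (λ _ a~x → ~-isohypse a∈Δⁿ a~x)
    , class-connected _
    , (_ , ε)
    , λ D Cls⊆D D⊆Δⁿ D-conn x dx → path⇒~ n≢0 D⊆Δⁿ (D-conn _ x (Cls⊆D _ ε) dx)

  component-is-class : ∀ {n} {B : Subset k} {x} → n ≢ 0 →
                       IsComponent (Isohypse Δ n) B → B x → B ≐ Cls x
  component-is-class {B = B} {x} n≢0 (B⊆Δⁿ , B-conn , _ , B-maximal) bx y =
    B⊆Cls y , B-maximal (Cls x) B⊆Cls (λ _ x~z → ~-isohypse (B⊆Δⁿ x bx) x~z) (class-connected x) y
    where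
    B⊆Cls : B ⊆ Cls x
    B⊆Cls y by = path⇒~ n≢0 B⊆Δⁿ (B-conn x y bx by)

  component-≐ : ∀ {A S T : Subset k} → S ≐ T → IsComponent A T → IsComponent A S
  component-≐ {S = S} {T} S≐T (T⊆A , T-conn , (x , tx) , T-maximal) =
      (λ y sy → T⊆A y (to y sy))
    , (λ y z sy sz → Star.map (λ (ty , tz , adj) → from _ ty , from _ tz , adj)
                              (T-conn y z (to y sy) (to z sz)))
    , (x , from x tx)
    , (λ D S⊆D D⊆A D-conn y dy → from y (T-maximal D (λ z tz → S⊆D z (from z tz)) D⊆A D-conn y dy))
    where
    to : S ⊆ T
    to y = proj₁ (S≐T y)
    from : T ⊆ S
    from y = proj₂ (S≐T y)

  labels : ∀ (S : Subset k) (n : ℕ) → G'Label Δ S n ⇔ CLabel S n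
  labels S n = mk⇔ to from
    where
    to : G'Label Δ S n → CLabel S n
    to (n≥1 , S-comp@(S⊆Δⁿ , _ , (x , sx) , _)) =
      x , isohypse-node₀ (n>0⇒n≢0 n≥1) (S⊆Δⁿ x sx) , component-is-class (n>0⇒n≢0 n≥1) S-comp sx
        , proj₂ (S⊆Δⁿ x sx)
    from : CLabel S n → G'Label Δ S n
    from (a , (a∈ , ha≢0) , S≐Cls , refl) =
      n≢0⇒n>0 ha≢0 , component-≐ S≐Cls (class-is-component ha≢0 (a∈ , refl))

  nodes : ∀ (S : Subset k) → G'Node Δ S ⇔ CNode S
  nodes S = mk⇔
    (λ (n , S-label) → let (a , a-node , S≐Cls , _) = Equivalence.to (labels S n) S-label
                        in a , a-node , S≐Cls)
    (λ (a , a-node , S≐Cls) → h Δ a , Equivalence.from (labels S (h Δ a)) (a , a-node , S≐Cls , refl))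

  node-node₀ : ∀ {S : Subset k} {x} → G'Node Δ S → S x → Node₀ x
  node-node₀ (n , n≥1 , S⊆Δⁿ , _) sx = isohypse-node₀ (n>0⇒n≢0 n≥1) (S⊆Δⁿ _ sx)

  -- edges of either graph are witnessed by a unit step between node sets;
  -- in the canonicalization both endpoints must moreover survive label 0
  edges : ∀ (S T : Subset k) → G'Node Δ S → G'Node Δ T → G'Edge Δ S T ⇔ CEdge S T
  edges S T S-node T-node = mk⇔
    (λ (S≠T , γ' , γ , sγ' , tγ , i , γ'≡γ+eᵢ) →
      let γ'-node = node-node₀ S-node sγ' ; γ-node = node-node₀ T-node tγ
      in S≠T , γ' , γ , sγ' , tγ , γ'-node , γ-node , proj₁ γ'-node , proj₁ γ-node , i , γ'≡γ+eᵢ)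
    (λ (S≠T , γ' , γ , sγ' , tγ , _ , _ , _ , _ , i , γ'≡γ+eᵢ) → S≠T , γ' , γ , sγ' , tγ , i , γ'≡γ+eᵢ)

proposition7p2 : ∀ (k : ℕ) (Δ : List (Pt (suc k))) → Unique Δ → IsStandardSet Δ →
    IsStandardGraph (GΔ Δ)
    × (∀ (S : Subset k) → G'Node Δ S ⇔ Canon.CNode (GΔ Δ) S)
    × (∀ (S : Subset k) (n : ℕ) → G'Label Δ S n ⇔ Canon.CLabel (GΔ Δ) S n)
    × (∀ (S T : Subset k) → G'Node Δ S → G'Node Δ T → G'Edge Δ S T ⇔ Canon.CEdge (GΔ Δ) S T)
proposition7p2 k Δ uΔ std = GΔ-standard uΔ std , nodes , labels , edges
  where open Components Δ
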